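{- Let $\mathbf{K}$ be a finite set of finite subdirectly irreducible Heyting algebras with involution. Then there exists a common killer for the algebras in $\mathbf{K}$, i.e. a unary term $k(x)$ in the language $\lor,\land,\to,\neg,\sim,0,1$ such that for every $\mathbf{A}\in\mathbf{K}$ and every $a\in A$, $k^{\mathbf{A}}(a)=1$ if $a=1$ and $k^{\mathbf{A}}(a)=0$ if $a\neq 1$.
   Context: A Heyting algebra with involution is an algebra $\langle A,\lor,\land,\to,\neg,\sim,0,1\rangle$ where $\langle A,\lor,\land,\to,\neg,0,1\rangle$ is a Heyting algebra ($a\to b=\sup\{x:a\land x\le b\}$, $\neg a=a\to 0$) and $\sim$ satisfies $\sim(a\lor b)=\sim a\land\sim b$ and $\sim\sim a=a$. An algebra is subdirectly irreducible if whenever an intersection of a family of its congruences equals the identity relation $\Delta$, one of the congruences equals $\Delta$. -}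

module Defs where

open import Level using (0ℓ)
open import Data.Nat using (ℕ)
open import Data.Fin using (Fin)
open import Data.Product using (Σ; ∃; _×_; _,_)
open import Data.List using (List)
open import Relation.Binary.PropositionalEquality using (_≡_; _≢_)
open import Relation.Binary.Structures using (IsEquivalence)
open import Function.Bundles using (_↔_)

record HIA : Set₁ where
  infixr 5 _⇒_
  infixr 6 _∨_
  infixr 7 _∧_
  field
    Carrier : Set
    _∨_ _∧_ _⇒_ : Carrier → Carrier → Carrier
    ¬_ ∼_ : Carrier → Carrier
    𝟘 𝟙 : Carrier

  _≤_ : Carrier → Carrier → Set
  a ≤ b = a ∧ b ≡ a

  field
    ∨-assoc : ∀ a b c → (a ∨ b) ∨ c ≡ a ∨ (b ∨ c)
    ∧-assoc : ∀ a b c → (a ∧ b) ∧ c ≡ a ∧ (b ∧ c)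
    ∨-comm  : ∀ a b → a ∨ b ≡ b ∨ a
    ∧-comm  : ∀ a b → a ∧ b ≡ b ∧ a
    ∨-absorbs-∧ : ∀ a b → a ∨ (a ∧ b) ≡ a
    ∧-absorbs-∨ : ∀ a b → a ∧ (a ∨ b) ≡ a
    𝟘-least    : ∀ a → 𝟘 ≤ a
    𝟙-greatest : ∀ a → a ≤ 𝟙
    ⇒-intro : ∀ a b x → (a ∧ x) ≤ b → x ≤ (a ⇒ b)
    ⇒-elim  : ∀ a b x → x ≤ (a ⇒ b) → (a ∧ x) ≤ b
    ¬-def : ∀ a → ¬ a ≡ a ⇒ 𝟘
    ∼-∨   : ∀ a b → ∼ (a ∨ b) ≡ (∼ a) ∧ (∼ b)
    ∼-inv : ∀ a → ∼ (∼ a) ≡ a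

module _ (A : HIA) where
  open HIA A

  IsFinite : Set
  IsFinite = ∃ λ n → Carrier ↔ Fin n

  record IsCongruence (θ : Carrier → Carrier → Set) : Set where
    field
      isEquivalence : IsEquivalence θ
      ∨-cong : ∀ {a b c d} → θ a b → θ c d → θ (a ∨ c) (b ∨ d)
      ∧-cong : ∀ {a b c d} → θ a b → θ c d → θ (a ∧ c) (b ∧ d)
      ⇒-cong : ∀ {a b c d} → θ a b → θ c d → θ (a ⇒ c) (b ⇒ d)
      ¬-cong : ∀ {a b} → θ a b → θ (¬ a) (¬ b)
      ∼-cong : ∀ {a b} → θ a b → θ (∼ a) (∼ b)

  -- θ equals the identity relation Δ (reflexivity holds since θ is a congruence)
  IsIdentity : (Carrier → Carrier → Set) → Set
  IsIdentity θ = ∀ a b → θ a b → a ≡ b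

  IsSubdirectlyIrreducible : Set₁
  IsSubdirectlyIrreducible =
    (I : Set) (θ : I → Carrier → Carrier → Set) →
    (∀ i → IsCongruence (θ i)) →
    IsIdentity (λ a b → ∀ i → θ i a b) →
    Σ I λ i → IsIdentity (θ i)

data Term : Set where
  x     : Term
  _∨ₜ_ _∧ₜ_ _⇒ₜ_ : Term → Term → Term
  ¬ₜ_ ∼ₜ_ : Term → Term
  0ₜ 1ₜ : Term

⟦_⟧ : Term → (A : HIA) → HIA.Carrier A → HIA.Carrier A
⟦ x ⟧ A a = a
⟦ t ∨ₜ s ⟧ A a = HIA._∨_ A (⟦ t ⟧ A a) (⟦ s ⟧ A a)
⟦ t ∧ₜ s ⟧ A a = HIA._∧_ A (⟦ t ⟧ A a) (⟦ s ⟧ A a)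
⟦ t ⇒ₜ s ⟧ A a = HIA._⇒_ A (⟦ t ⟧ A a) (⟦ s ⟧ A a)
⟦ ¬ₜ t ⟧ A a = HIA.¬_ A (⟦ t ⟧ A a)
⟦ ∼ₜ t ⟧ A a = HIA.∼_ A (⟦ t ⟧ A a)
⟦ 0ₜ ⟧ A a = HIA.𝟘 A
⟦ 1ₜ ⟧ A a = HIA.𝟙 A

IsKiller : Term → HIA → Set
IsKiller k A = ∀ (a : HIA.Carrier A) →
  (a ≡ HIA.𝟙 A → ⟦ k ⟧ A a ≡ HIA.𝟙 A) × (a ≢ HIA.𝟙 A → ⟦ k ⟧ A a ≡ HIA.𝟘 A)

-- For d(u) = u ∧ ¬∼u the sequence a, d(a), d²(a), … decreases, so in a finite
-- algebra it reaches a fixed point c of d, and c ∧ ∼c = 0 as c ≤ ¬∼c.  Then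
-- c ∨ ∼c = 1, so the congruences u θ v ⇔ c ∧ u = c ∧ v and u θ′ v ⇔ ∼c ∧ u = ∼c ∧ v
-- meet in Δ; subdirect irreducibility makes one of them Δ, which forces c = 1 or c = 0.
-- As c ≤ a, the term dᴺ(x) is a killer once N bounds the sizes of all the algebras.
module Submission where

open import Defs
open import Level using (0ℓ)
open import Data.Product using (Σ; ∃; _×_; _,_; proj₁)
open import Data.Sum using (_⊎_; inj₁; inj₂)
open import Data.Empty using (⊥-elim)
open import Data.Bool using (Bool; true; false)
open import Data.List using (List; _∷_)
open import Data.List.Relation.Unary.All using (All; []; _∷_)
open import Data.Nat as ℕ using (ℕ; zero; suc; _+_; _∸_; _⊔_)
import Data.Nat.Properties as ℕₚ
open import Data.Nat.GeneralisedArithmetic using (fold; fold-+)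
open import Data.Fin using (Fin; toℕ)
open import Data.Fin.Properties using (pigeonhole; toℕ≤pred[n])
open import Function.Bundles using (_↔_; Inverse; Injection)
open import Function.Properties.Inverse using (Inverse⇒Injection)
open import Relation.Binary.Core using (Rel)
open import Relation.Binary.Structures using (IsPartialOrder)
open import Relation.Binary.PropositionalEquality
  using (_≡_; _≢_; refl; sym; trans; cong; cong₂; subst; subst₂; isEquivalence; module ≡-Reasoning)
open import Algebra.Lattice.Bundles using (Lattice)
import Algebra.Lattice.Properties.Lattice as LatticeProperties
import Relation.Binary.Lattice as Order
import Relation.Binary.Lattice.Properties.HeytingAlgebra as HeytingAlgebraProperties
import Relation.Binary.Lattice.Properties.DistributiveLattice as DistributiveLatticeProperties

module _ {a} {A : Set a} (f : A → A) where

  fold-fixedPoint : ∀ {z} → f z ≡ z → ∀ k → fold z f k ≡ z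
  fold-fixedPoint fz≡z zero    = refl
  fold-fixedPoint fz≡z (suc k) = trans (cong f (fold-fixedPoint fz≡z k)) fz≡z

  fold-constant : ∀ z {m n} → f (fold z f m) ≡ fold z f m → m ℕ.≤ n →
                  fold z f n ≡ fold z f m
  fold-constant z {m} {n} fixed m≤n = begin
    fold z f n                   ≡⟨ cong (fold z f) (sym (ℕₚ.m∸n+n≡m m≤n)) ⟩
    fold z f (n ∸ m + m)         ≡⟨ fold-+ z f (n ∸ m) ⟩
    fold (fold z f m) f (n ∸ m)  ≡⟨ fold-fixedPoint fixed (n ∸ m) ⟩
    fold z f m                   ∎
    where open ≡-Reasoning

  module _ {ℓ} {_≼_ : Rel A ℓ} (isPartialOrder : IsPartialOrder _≡_ _≼_)
           (deflationary : ∀ u → f u ≼ u) where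
    open IsPartialOrder isPartialOrder
      using (antisym; reflexive) renaming (refl to ≼-refl; trans to ≼-trans)

    fold-≼ : ∀ z k → fold z f k ≼ z
    fold-≼ z zero    = ≼-refl
    fold-≼ z (suc k) = ≼-trans (deflationary _) (fold-≼ z k)

    fold-antitone : ∀ z {m n} → m ℕ.≤ n → fold z f n ≼ fold z f m
    fold-antitone z {m} {n} m≤n = ≼-trans
      (reflexive (trans (cong (fold z f) (sym (ℕₚ.m∸n+n≡m m≤n))) (fold-+ z f (n ∸ m))))
      (fold-≼ (fold z f m) (n ∸ m))

    -- Pigeonhole gives i < j with fⁱ z = fʲ z, and fⁱ z ≽ fⁱ⁺¹ z ≽ fʲ z squeezes fⁱ⁺¹ z = fⁱ z.
    fold-stabilises : ∀ {n} → A ↔ Fin n → ∀ z {N} → n ℕ.≤ N →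
                      f (fold z f N) ≡ fold z f N
    fold-stabilises {n} A↔Fin z {N} n≤N
      with pigeonhole (ℕₚ.n<1+n n) (λ i → Inverse.to A↔Fin (fold z f (toℕ i)))
    ... | i , j , i<j , same-code = begin
      f (fold z f N)         ≡⟨ cong f (fold-constant z fixed i≤N) ⟩
      f (fold z f (toℕ i))   ≡⟨ fixed ⟩
      fold z f (toℕ i)       ≡⟨ fold-constant z fixed i≤N ⟨
      fold z f N             ∎
      where
      open ≡-Reasoning
      same : fold z f (toℕ i) ≡ fold z f (toℕ j)
      same = Injection.injective (Inverse⇒Injection A↔Fin) same-code
      fixed : f (fold z f (toℕ i)) ≡ fold z f (toℕ i)
      fixed = antisym (deflationary _) (≼-trans (reflexive same) (fold-antitone z i<j))
      i≤N : toℕ i ℕ.≤ N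
      i≤N = ℕₚ.≤-trans (ℕₚ.<⇒≤ (ℕₚ.≤-trans i<j (toℕ≤pred[n] j))) n≤N

d-term : ℕ → Term
d-term zero    = x
d-term (suc n) = d-term n ∧ₜ (¬ₜ (∼ₜ d-term n))

module HIAProperties (A : HIA) where
  open HIA A hiding (_≤_)

  lattice : Lattice 0ℓ 0ℓ
  lattice = record
    { Carrier   = Carrier
    ; _≈_       = _≡_
    ; _∨_       = _∨_
    ; _∧_       = _∧_
    ; isLattice = record
      { isEquivalence = isEquivalence
      ; ∨-comm        = ∨-comm
      ; ∨-assoc       = ∨-assoc
      ; ∨-cong        = cong₂ _∨_
      ; ∧-comm        = ∧-comm
      ; ∧-assoc       = ∧-assoc
      ; ∧-cong        = cong₂ _∧_
      ; absorptive    = ∨-absorbs-∧ , ∧-absorbs-∨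
      }
    }

  open LatticeProperties lattice using (∨-∧-isOrderTheoreticLattice)

  -- The order is the library's u ≤ v ⇔ u ≡ u ∧ v, the symmetric form of HIA._≤_.
  heytingAlgebra : Order.HeytingAlgebra 0ℓ 0ℓ 0ℓ
  heytingAlgebra = record
    { isHeytingAlgebra = record
      { isBoundedLattice = record
        { isLattice = ∨-∧-isOrderTheoreticLattice
        ; maximum   = λ u → sym (𝟙-greatest u)
        ; minimum   = λ u → sym (𝟘-least u)
        }
      ; exponential = λ w u v →
          (λ w∧u≤v → sym (⇒-intro u v w (trans (cong (_∧ v) (∧-comm u w))
                          (trans (sym w∧u≤v) (∧-comm w u)))))
        , (λ w≤u⇒v → trans (∧-comm w u) (trans (sym (⇒-elim u v w (sym w≤u⇒v)))
                          (cong (_∧ v) (∧-comm u w))))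
      }
    }

  open Order.HeytingAlgebra heytingAlgebra
    using (_≤_; isPartialOrder; antisym; reflexive; maximum; minimum;
           x∧y≤x; x∧y≤y; ∧-greatest) renaming (trans to ≤-trans)
  open HeytingAlgebraProperties heytingAlgebra
    using (⇨-eval; ⇨-app; ⇨-unit; ⇨-curry; ⇨-distribˡ-∧; y≤x⇨y; ∧-distribˡ-∨)
  open DistributiveLatticeProperties (HeytingAlgebraProperties.distributiveLattice heytingAlgebra)
    using (∧-distribʳ-∨)
  open import Relation.Binary.Lattice.Properties.MeetSemilattice
    (Order.HeytingAlgebra.meetSemilattice heytingAlgebra)
    using (∧-idempotent; ∧-monotonic)
  open import Relation.Binary.Lattice.Properties.JoinSemilattice
    (Order.HeytingAlgebra.joinSemilattice heytingAlgebra)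
    using (x≤y⇒x∨y≈y)

  ∧-distribˡ-∧ : ∀ e u v → e ∧ (u ∧ v) ≡ (e ∧ u) ∧ (e ∧ v)
  ∧-distribˡ-∧ e u v = antisym
    (∧-greatest (∧-monotonic (reflexive refl) (x∧y≤x u v))
                (∧-monotonic (reflexive refl) (x∧y≤y u v)))
    (∧-greatest (≤-trans (x∧y≤x _ _) (x∧y≤x e u))
                (∧-greatest (≤-trans (x∧y≤x _ _) (x∧y≤y e u)) (≤-trans (x∧y≤y _ _) (x∧y≤y e v))))

  ∧-⇨-absorbs : ∀ e u → e ∧ (e ⇒ u) ≡ e ∧ u
  ∧-⇨-absorbs e u = trans (∧-comm e _) (trans ⇨-app (∧-comm u e))

  ∧-⇨-localise : ∀ e u v → e ∧ (u ⇒ v) ≡ e ∧ (e ∧ u ⇒ e ∧ v)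
  ∧-⇨-localise e u v = begin
    e ∧ (u ⇒ v)                       ≡⟨ ∧-⇨-absorbs e (u ⇒ v) ⟨
    e ∧ (e ⇒ u ⇒ v)                   ≡⟨ cong (e ∧_) ⇨-curry ⟨
    e ∧ (e ∧ u ⇒ v)                   ≡⟨ cong (_∧ (e ∧ u ⇒ v)) y≤x⇨y ⟩
    (e ∧ (e ∧ u ⇒ e)) ∧ (e ∧ u ⇒ v)   ≡⟨ ∧-assoc e _ _ ⟩
    e ∧ ((e ∧ u ⇒ e) ∧ (e ∧ u ⇒ v))   ≡⟨ cong (e ∧_) (⇨-distribˡ-∧ (e ∧ u) e v) ⟨
    e ∧ (e ∧ u ⇒ e ∧ v)               ∎
    where open ≡-Reasoning

  ∼-antitone : ∀ {u v} → u ≤ v → ∼ v ≤ ∼ u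
  ∼-antitone {u} {v} u≤v =
    trans (cong ∼_ (sym (x≤y⇒x∨y≈y u≤v))) (trans (∼-∨ u v) (∧-comm (∼ u) (∼ v)))

  ∼-𝟘 : ∼ 𝟘 ≡ 𝟙
  ∼-𝟘 = antisym (maximum (∼ 𝟘)) (subst (_≤ ∼ 𝟘) (∼-inv 𝟙) (∼-antitone (minimum (∼ 𝟙))))

  ∼-𝟙 : ∼ 𝟙 ≡ 𝟘
  ∼-𝟙 = trans (cong ∼_ (sym ∼-𝟘)) (∼-inv 𝟘)

  ∼-∧ : ∀ u v → ∼ (u ∧ v) ≡ ∼ u ∨ ∼ v
  ∼-∧ u v = begin
    ∼ (u ∧ v)              ≡⟨ cong ∼_ (cong₂ _∧_ (∼-inv u) (∼-inv v)) ⟨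
    ∼ (∼ ∼ u ∧ ∼ ∼ v)      ≡⟨ cong ∼_ (∼-∨ (∼ u) (∼ v)) ⟨
    ∼ ∼ (∼ u ∨ ∼ v)        ≡⟨ ∼-inv (∼ u ∨ ∼ v) ⟩
    ∼ u ∨ ∼ v              ∎
    where open ≡-Reasoning

  ¬-𝟘 : ¬ 𝟘 ≡ 𝟙
  ¬-𝟘 = trans (¬-def 𝟘) ⇨-unit

  𝟘-∨ : ∀ u → 𝟘 ∨ u ≡ u
  𝟘-∨ u = x≤y⇒x∨y≈y (minimum u)

  ∼-disjoint⇒∨-∼≡𝟙 : ∀ {e} → e ∧ ∼ e ≡ 𝟘 → e ∨ ∼ e ≡ 𝟙
  ∼-disjoint⇒∨-∼≡𝟙 {e} e∧∼e≡𝟘 = begin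
    e ∨ ∼ e        ≡⟨ ∨-comm e (∼ e) ⟩
    ∼ e ∨ e        ≡⟨ cong (∼ e ∨_) (∼-inv e) ⟨
    ∼ e ∨ ∼ ∼ e    ≡⟨ ∼-∧ e (∼ e) ⟨
    ∼ (e ∧ ∼ e)    ≡⟨ cong ∼_ e∧∼e≡𝟘 ⟩
    ∼ 𝟘            ≡⟨ ∼-𝟘 ⟩
    𝟙              ∎
    where open ≡-Reasoning

  MeetKernel : Carrier → Rel Carrier 0ℓ
  MeetKernel e u v = e ∧ u ≡ e ∧ v

  module _ {e : Carrier} where

    private
      preserves₁ : ∀ {op : Carrier → Carrier} (g : Carrier → Carrier) →
                   (∀ u → e ∧ op u ≡ g (e ∧ u)) →
                   ∀ {a b} → MeetKernel e a b → MeetKernel e (op a) (op b)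
      preserves₁ g factors {a} {b} a~b =
        trans (factors a) (trans (cong g a~b) (sym (factors b)))

      preserves₂ : ∀ {op : Carrier → Carrier → Carrier} (g : Carrier → Carrier → Carrier) →
                   (∀ u v → e ∧ op u v ≡ g (e ∧ u) (e ∧ v)) →
                   ∀ {a b c d} → MeetKernel e a b → MeetKernel e c d →
                   MeetKernel e (op a c) (op b d)
      preserves₂ g factors {a} {b} {c} {d} a~b c~d =
        trans (factors a c) (trans (cong₂ g a~b c~d) (sym (factors b d)))

    ∧-∼-localise : e ∧ ∼ e ≡ 𝟘 → ∀ u → e ∧ ∼ u ≡ e ∧ ∼ (e ∧ u)
    ∧-∼-localise e∧∼e≡𝟘 u = sym (begin
      e ∧ ∼ (e ∧ u)              ≡⟨ cong (e ∧_) (∼-∧ e u) ⟩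
      e ∧ (∼ e ∨ ∼ u)            ≡⟨ ∧-distribˡ-∨ e (∼ e) (∼ u) ⟩
      (e ∧ ∼ e) ∨ (e ∧ ∼ u)      ≡⟨ cong (_∨ (e ∧ ∼ u)) e∧∼e≡𝟘 ⟩
      𝟘 ∨ (e ∧ ∼ u)              ≡⟨ 𝟘-∨ (e ∧ ∼ u) ⟩
      e ∧ ∼ u                    ∎)
      where open ≡-Reasoning

    meetKernel-isCongruence : e ∧ ∼ e ≡ 𝟘 → IsCongruence A (MeetKernel e)
    meetKernel-isCongruence e∧∼e≡𝟘 = record
      { isEquivalence = record { refl = refl ; sym = sym ; trans = trans }
      ; ∨-cong = preserves₂ _∨_ (∧-distribˡ-∨ e)
      ; ∧-cong = preserves₂ _∧_ (∧-distribˡ-∧ e)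
      ; ⇒-cong = ⇒-cong
      ; ¬-cong = λ {a} {b} a~b →
          subst₂ (MeetKernel e) (sym (¬-def a)) (sym (¬-def b)) (⇒-cong a~b refl)
      ; ∼-cong = preserves₁ (λ w → e ∧ ∼ w) (∧-∼-localise e∧∼e≡𝟘)
      }
      where
      ⇒-cong : ∀ {a b c d} → MeetKernel e a b → MeetKernel e c d →
               MeetKernel e (a ⇒ c) (b ⇒ d)
      ⇒-cong = preserves₂ (λ v w → e ∧ (v ⇒ w)) (∧-⇨-localise e)

    meetKernel-isIdentity⇒≡𝟙 : IsIdentity A (MeetKernel e) → e ≡ 𝟙
    meetKernel-isIdentity⇒≡𝟙 isIdentity = isIdentity e 𝟙 (trans (∧-idempotent e) (maximum e))

  ∼-disjoint⇒≡𝟘⊎≡𝟙 : IsSubdirectlyIrreducible A → ∀ {e} → e ∧ ∼ e ≡ 𝟘 → e ≡ 𝟘 ⊎ e ≡ 𝟙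
  ∼-disjoint⇒≡𝟘⊎≡𝟙 isSI {e} e∧∼e≡𝟘
    with isSI Bool kernel kernel-isCongruence kernels-meet-in-Δ
    where
    ∼e∧∼∼e≡𝟘 : ∼ e ∧ ∼ ∼ e ≡ 𝟘
    ∼e∧∼∼e≡𝟘 = trans (cong (∼ e ∧_) (∼-inv e)) (trans (∧-comm (∼ e) e) e∧∼e≡𝟘)
    kernel : Bool → Rel Carrier 0ℓ
    kernel true  = MeetKernel e
    kernel false = MeetKernel (∼ e)
    kernel-isCongruence : ∀ i → IsCongruence A (kernel i)
    kernel-isCongruence true  = meetKernel-isCongruence e∧∼e≡𝟘
    kernel-isCongruence false = meetKernel-isCongruence ∼e∧∼∼e≡𝟘
    split : ∀ u → u ≡ (e ∧ u) ∨ (∼ e ∧ u)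
    split u = begin
      u                      ≡⟨ trans (maximum u) (∧-comm u 𝟙) ⟩
      𝟙 ∧ u                  ≡⟨ cong (_∧ u) (∼-disjoint⇒∨-∼≡𝟙 e∧∼e≡𝟘) ⟨
      (e ∨ ∼ e) ∧ u          ≡⟨ ∧-distribʳ-∨ u e (∼ e) ⟩
      (e ∧ u) ∨ (∼ e ∧ u)    ∎
      where open ≡-Reasoning
    kernels-meet-in-Δ : IsIdentity A (λ u v → ∀ i → kernel i u v)
    kernels-meet-in-Δ u v u~v =
      trans (split u) (trans (cong₂ _∨_ (u~v true) (u~v false)) (sym (split v)))
  ... | true  , Δ = inj₂ (meetKernel-isIdentity⇒≡𝟙 Δ)
  ... | false , Δ = inj₁ (trans (sym (∼-inv e)) (trans (cong ∼_ (meetKernel-isIdentity⇒≡𝟙 Δ)) ∼-𝟙))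

  d : Carrier → Carrier
  d u = u ∧ ¬ ∼ u

  ⟦d-term⟧ : ∀ n u → ⟦ d-term n ⟧ A u ≡ fold u d n
  ⟦d-term⟧ zero    u = refl
  ⟦d-term⟧ (suc n) u = cong d (⟦d-term⟧ n u)

  d-deflationary : ∀ u → d u ≤ u
  d-deflationary u = x∧y≤x u (¬ ∼ u)

  d-𝟙 : d 𝟙 ≡ 𝟙
  d-𝟙 = trans (cong (λ w → 𝟙 ∧ ¬ w) ∼-𝟙) (trans (cong (𝟙 ∧_) ¬-𝟘) (∧-idempotent 𝟙))

  d-fixed⇒∼-disjoint : ∀ {c} → d c ≡ c → c ∧ ∼ c ≡ 𝟘
  d-fixed⇒∼-disjoint {c} dc≡c = antisym c∧∼c≤𝟘 (minimum (c ∧ ∼ c))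
    where
    c∧∼c≤𝟘 : c ∧ ∼ c ≤ 𝟘
    c∧∼c≤𝟘 = ≤-trans (∧-monotonic (sym dc≡c) (reflexive refl))
                     (subst (λ w → w ∧ ∼ c ≤ 𝟘) (sym (¬-def (∼ c))) ⇨-eval)

  ⟦d-term⟧-𝟙 : ∀ N → ⟦ d-term N ⟧ A 𝟙 ≡ 𝟙
  ⟦d-term⟧-𝟙 N = trans (⟦d-term⟧ N 𝟙) (fold-fixedPoint d d-𝟙 N)

  isKiller-d-term : (finite : IsFinite A) → IsSubdirectlyIrreducible A →
                    ∀ {N} → proj₁ finite ℕ.≤ N → IsKiller (d-term N) A
  isKiller-d-term (n , A↔Fin) isSI {N} n≤N a =
    (λ a≡𝟙 → trans (cong (⟦ d-term N ⟧ A) a≡𝟙) (⟦d-term⟧-𝟙 N)) , a≢𝟙⇒𝟘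
    where
    a≢𝟙⇒𝟘 : a ≢ 𝟙 → ⟦ d-term N ⟧ A a ≡ 𝟘
    a≢𝟙⇒𝟘 a≢𝟙
      with ∼-disjoint⇒≡𝟘⊎≡𝟙 isSI
             (d-fixed⇒∼-disjoint (fold-stabilises d isPartialOrder d-deflationary A↔Fin a n≤N))
    ... | inj₁ dᴺa≡𝟘 = trans (⟦d-term⟧ N a) dᴺa≡𝟘
    ... | inj₂ dᴺa≡𝟙 = ⊥-elim (a≢𝟙 (antisym (maximum a)
            (subst (_≤ a) dᴺa≡𝟙 (fold-≼ d isPartialOrder d-deflationary a N))))

killers-eventually : ∀ {K} → All (λ A → IsFinite A × IsSubdirectlyIrreducible A) K →
                     ∃ λ N → ∀ {M} → N ℕ.≤ M → All (IsKiller (d-term M)) K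
killers-eventually [] = 0 , λ _ → []
killers-eventually {A ∷ _} ((finite , isSI) ∷ rest) =
  let N , killers = killers-eventually rest in
  proj₁ finite ⊔ N , λ bound →
    HIAProperties.isKiller-d-term A finite isSI (ℕₚ.m⊔n≤o⇒m≤o _ N bound)
    ∷ killers (ℕₚ.m⊔n≤o⇒n≤o (proj₁ finite) N bound)

lemma4p1 : (K : List HIA) →
    All (λ A → IsFinite A × IsSubdirectlyIrreducible A) K →
    Σ Term (λ k → All (IsKiller k) K)
lemma4p1 K finite-SI =
  let N , killers = killers-eventually finite-SI in d-term N , killers ℕₚ.≤-refl
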